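{- Let $t$ be a positive integer and let $([n],\mathcal{B})$ be a $t$-wise packing. Define $\mathcal{F} = \bigcup_{K \in \mathcal{B}} \mathcal{E}_K$, where for each block $K \in \mathcal{B}$, $\mathcal{E}_K$ is an arbitrary $t$-laminar family of subsets of $K$. Then $\mathcal{F}$ is a $t$-laminar family of subsets of $[n]$.
   Context: $[n]=\{1,\dots,n\}$. A family $\mathcal{F}$ of subsets of a set $X$ is $t$-laminar if whenever $A,B \in \mathcal{F}$ satisfy $|A \cap B| \ge t$, we have $A \subseteq B$ or $B \subseteq A$. A $t$-wise packing is a pair $(V,\mathcal{B})$ where $V$ is a finite set of points and $\mathcal{B}$ is a collection of subsets of $V$ (blocks), each of size at least $t$, such that every $t$-subset of $V$ is contained in at most one block. -}

module Defs where

open import Data.Nat using (ℕ; _≤_; _≥_)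
open import Data.Fin using (Fin)
open import Data.Fin.Subset using (Subset; _⊆_; _∩_; ∣_∣)
open import Data.List using (List; length; lookup; concat; tabulate)
open import Data.List.Membership.Propositional using (_∈_)
open import Data.Product using (_×_)
open import Data.Sum using (_⊎_)
open import Relation.Binary.PropositionalEquality using (_≡_)

tLaminar : {n : ℕ} → ℕ → List (Subset n) → Set
tLaminar t 𝓕 = ∀ {A B} → A ∈ 𝓕 → B ∈ 𝓕 → ∣ A ∩ B ∣ ≥ t → (A ⊆ B) ⊎ (B ⊆ A)

FamilyOf : {n : ℕ} → Subset n → List (Subset n) → Set
FamilyOf K 𝓔 = ∀ {A} → A ∈ 𝓔 → A ⊆ K

IsPacking : {n : ℕ} → ℕ → List (Subset n) → Set
IsPacking {n} t 𝓑 =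
  ((i : Fin (length 𝓑)) → ∣ lookup 𝓑 i ∣ ≥ t) ×
  ((S : Subset n) → ∣ S ∣ ≡ t → (i j : Fin (length 𝓑)) →
     S ⊆ lookup 𝓑 i → S ⊆ lookup 𝓑 j → i ≡ j)

unionFamily : {n : ℕ} (𝓑 : List (Subset n)) →
  (Fin (length 𝓑) → List (Subset n)) → List (Subset n)
unionFamily 𝓑 𝓔 = concat (tabulate 𝓔)

module Submission where

open import Defs
open import Data.Nat using (ℕ; _≤_; zero; suc; s≤s)
open import Data.Fin using (Fin)
open import Data.Fin.Subset using (Subset; _⊆_; _∩_; ∣_∣; ⊥; inside; outside)
open import Data.Fin.Subset.Properties
  using (⊥⊆; ∣⊥∣≡0; out⊆; in⊆in; ⊆-trans; p∩q⊆p; p∩q⊆q)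
open import Data.List using (List; length; lookup; tabulate)
open import Data.List.Membership.Propositional using (_∈_)
open import Data.List.Membership.Propositional.Properties using (∈-concat⁻′; ∈-tabulate⁻)
open import Data.Vec using (_∷_)
open import Data.Product using (_×_; _,_; ∃-syntax; proj₁; proj₂)
open import Data.Sum using (_⊎_)
open import Relation.Binary.PropositionalEquality using (_≡_; refl; cong)

-- Proof idea: if A ∈ 𝓔_K and B ∈ 𝓔_L share at least t points, any t of them form a
-- t-subset lying in both blocks K and L, so the packing property forces K = L, and
-- the t-laminarity of the single family 𝓔_K applies.

∃-subset-of-size : ∀ {n} t (X : Subset n) → t ≤ ∣ X ∣ → ∃[ S ] S ⊆ X × ∣ S ∣ ≡ t
∃-subset-of-size {n} zero X _ = ⊥ , ⊥⊆ , ∣⊥∣≡0 n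
∃-subset-of-size t (outside ∷ X) t≤∣X∣ =
  let S , S⊆X , ∣S∣≡t = ∃-subset-of-size t X t≤∣X∣ in outside ∷ S , out⊆ S⊆X , ∣S∣≡t
∃-subset-of-size (suc t) (inside ∷ X) (s≤s t≤∣X∣) =
  let S , S⊆X , ∣S∣≡t = ∃-subset-of-size t X t≤∣X∣ in inside ∷ S , in⊆in S⊆X , cong suc ∣S∣≡t

∈-unionFamily⁻ : ∀ {n} {𝓑 : List (Subset n)} {𝓔 : Fin (length 𝓑) → List (Subset n)} {A} →
  A ∈ unionFamily 𝓑 𝓔 → ∃[ i ] A ∈ 𝓔 i
∈-unionFamily⁻ {𝓔 = 𝓔} A∈𝓕 with ∈-concat⁻′ (tabulate 𝓔) A∈𝓕
... | _ , A∈𝓔ᵢ , 𝓔ᵢ∈ with ∈-tabulate⁻ 𝓔ᵢ∈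
...   | i , refl = i , A∈𝓔ᵢ

packing-blocks-≡ : ∀ {n t} {𝓑 : List (Subset n)} → IsPacking t 𝓑 → ∀ {A B} (i j : Fin (length 𝓑)) →
  A ⊆ lookup 𝓑 i → B ⊆ lookup 𝓑 j → t ≤ ∣ A ∩ B ∣ → i ≡ j
packing-blocks-≡ {t = t} (_ , unique) {A} {B} i j A⊆Kᵢ B⊆Kⱼ t≤∣A∩B∣ =
  let S , S⊆A∩B , ∣S∣≡t = ∃-subset-of-size t (A ∩ B) t≤∣A∩B∣ in
  unique S ∣S∣≡t i j (⊆-trans S⊆A∩B (⊆-trans (p∩q⊆p A B) A⊆Kᵢ))
                     (⊆-trans S⊆A∩B (⊆-trans (p∩q⊆q A B) B⊆Kⱼ))

mainTheorem2 : (t n : ℕ) → 1 ≤ t → (𝓑 : List (Subset n)) → IsPacking t 𝓑 →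
    (𝓔 : Fin (length 𝓑) → List (Subset n)) →
    ((i : Fin (length 𝓑)) → FamilyOf (lookup 𝓑 i) (𝓔 i) × tLaminar t (𝓔 i)) →
    tLaminar t (unionFamily 𝓑 𝓔)
mainTheorem2 t n _ 𝓑 packing 𝓔 H A∈𝓕 B∈𝓕 t≤∣A∩B∣
  with ∈-unionFamily⁻ {𝓑 = 𝓑} A∈𝓕 | ∈-unionFamily⁻ {𝓑 = 𝓑} B∈𝓕
... | i , A∈𝓔ᵢ | j , B∈𝓔ⱼ
  with packing-blocks-≡ {𝓑 = 𝓑} packing i j (proj₁ (H i) A∈𝓔ᵢ) (proj₁ (H j) B∈𝓔ⱼ) t≤∣A∩B∣
... | refl = proj₂ (H i) A∈𝓔ᵢ B∈𝓔ⱼ t≤∣A∩B∣
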